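{- Let $m\ge1$ and $n\ge1$ be integers, $S_{m;n}(t)=\sum_{k=0}^{n-1}T^{(m)}_{n,k}t^k$, and define \[ F_{m;n}(t)=\frac{S_{m;n}(t)}{(1-t)^{m(n-1)+2}},\qquad \widehat F_{m;n}(t)=\frac{t\,S_{m;n}(t)}{(1-t)^{mn+1}}. \] Then \[ \widehat F_{m;n}(t)=\frac{t}{(1-t)^{m-1}}F_{m;n}(t),\qquad \frac{d}{dt}\left(\frac{t}{(1-t)^{m-1}}F_{m;n}(t)\right)=F_{m;n+1}(t),\qquad t\frac{d}{dt}\widehat F_{m;n}(t)=(1-t)^{m-1}\widehat F_{m;n+1}(t). \] In particular, for $m=1$: $\widehat F_{1;n}(t)=tF_{1;n}(t)$, $\frac{d}{dt}(tF_{1;n}(t))=F_{1;n+1}(t)$, and $t\frac{d}{dt}\widehat F_{1;n}(t)=\widehat F_{1;n+1}(t)$.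
   Context: Let $m\ge1$, $n\ge1$ be integers. An $m$-Stirling permutation of order $n$ is a word $a_1a_2\cdots a_{mn}$ that is a permutation of the multiset in which each of $1,2,\dots,n$ occurs exactly $m$ times, such that whenever $u<v<w$ and $a_u=a_w$, one has $a_u\ge a_v$. A descent of such a word is an index $j\in\{1,\dots,mn-1\}$ with $a_j>a_{j+1}$. The $m$th-order Eulerian number $T^{(m)}_{n,k}$ is the number of $m$-Stirling permutations of order $n$ with exactly $k$ descents; by convention $T^{(m)}_{n,k}=0$ for $k<0$ or $k\ge n$, and $T^{(m)}_{1,0}=1$. The functions are regarded as rational functions (or for $t\neq1$). -}

module Defs where

open import Data.Bool using (Bool; true; false; _∧_; _∨_; not; if_then_else_)
open import Data.Nat using (ℕ; zero; suc; _+_; _*_; _∸_; _<ᵇ_; _≡ᵇ_)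
open import Data.List using (List; []; _∷_; map; concatMap; upTo)
open import Relation.Binary.PropositionalEquality using (_≡_)
open import Data.Integer using (ℤ; +_; _-_) renaming (_+_ to _+ℤ_; _*_ to _*ℤ_)

words : ℕ → ℕ → List (List ℕ)
words zero    n = [] ∷ []
words (suc L) n = concatMap (λ w → map (λ a → a ∷ w) (map suc (upTo n))) (words L n)

occ : ℕ → List ℕ → ℕ
occ i []       = 0
occ i (x ∷ xs) = (if x ≡ᵇ i then 1 else 0) + occ i xs

allB : (ℕ → Bool) → List ℕ → Bool
allB p []       = true
allB p (x ∷ xs) = p x ∧ allB p xs

-- the word is a permutation of the multiset {1^m, 2^m, …, n^m}
-- (letters lie in {1,…,n} by construction of `words`)
isMultiset : ℕ → ℕ → List ℕ → Bool
isMultiset m n w = allB (λ i → occ i w ≡ᵇ m) (map suc (upTo n))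

-- checkFrom x bad ys : for every later occurrence of x in ys, no letter
-- strictly greater than x occurs between (bad records whether one was seen)
checkFrom : ℕ → Bool → List ℕ → Bool
checkFrom x bad []       = true
checkFrom x bad (y ∷ ys) =
  (if y ≡ᵇ x then not bad else true) ∧ checkFrom x (bad ∨ (x <ᵇ y)) ys

-- Stirling condition: u < v < w and a_u = a_w imply a_u ≥ a_v
stirling : List ℕ → Bool
stirling []       = true
stirling (x ∷ xs) = checkFrom x false xs ∧ stirling xs

des : List ℕ → ℕ
des []           = 0
des (x ∷ [])     = 0
des (x ∷ y ∷ ys) = (if y <ᵇ x then 1 else 0) + des (y ∷ ys)

countB : {A : Set} → (A → Bool) → List A → ℕ
countB p []       = 0
countB p (x ∷ xs) = (if p x then 1 else 0) + countB p xs

T : ℕ → ℕ → ℕ → ℕ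
T m n k = countB (λ w → isMultiset m n w ∧ stirling w ∧ (des w ≡ᵇ k)) (words (m * n) n)

-- All the rational
-- functions in the statement have denominators that are powers of (1-t),
-- hence are represented faithfully by their power-series expansions.

PS : Set
PS = ℕ → ℤ

_≈ₚ_ : PS → PS → Set
f ≈ₚ g = ∀ k → f k ≡ g k
infix 4 _≈ₚ_

shiftT : PS → PS
shiftT f zero    = + 0
shiftT f (suc k) = f k

divOneMinus : PS → PS
divOneMinus f zero    = f zero
divOneMinus f (suc k) = divOneMinus f k +ℤ f (suc k)

mulOneMinus : PS → PS
mulOneMinus f zero    = f zero
mulOneMinus f (suc k) = f (suc k) - f k

iter : ℕ → (PS → PS) → PS → PS
iter zero    h f = f
iter (suc j) h f = h (iter j h f)

divPow : ℕ → PS → PS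
divPow j = iter j divOneMinus

mulPow : ℕ → PS → PS
mulPow j = iter j mulOneMinus

deriv : PS → PS
deriv f k = + (suc k) *ℤ f (suc k)

S : ℕ → ℕ → PS
S m n k = if k <ᵇ n then + (T m n k) else + 0

F : ℕ → ℕ → PS
F m n = divPow (m * (n ∸ 1) + 2) (S m n)

Fhat : ℕ → ℕ → PS
Fhat m n = divPow (m * n + 1) (shiftT (S m n))

-- Raising every letter of an m-Stirling permutation of order n by one and inserting
-- the block 1ᵐ into one of its mn + 1 gaps produces every m-Stirling permutation of
-- order n + 1 exactly once (the 1s of a Stirling permutation are contiguous).  The
-- insertion keeps the number of descents d when the gap is the front or sits inside a
-- descent (d + 1 gaps) and raises it by one otherwise (mn - d gaps), so
-- T(n+1,k) = (k+1) T(n,k) + (mn-k+1) T(n,k-1).  On coefficients this says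
-- (1-t)(t S_n)′ + (mn+1) t S_n = S_{n+1}, and the quotient rule
-- (g/(1-t)ᴺ)′ = ((1-t) g′ + N g)/(1-t)ᴺ⁺¹ with g = t S_n, N = mn + 1 turns it into the
-- second identity.  The first identity only compares exponents of 1 - t, and the
-- third follows from the first two.

{-# OPTIONS --safe #-}
module Submission where

open import Defs
open import Data.Bool using (Bool; true; false; _∧_; _∨_; not; if_then_else_)
import Data.Bool as Bool
open import Data.Bool.Properties using (∨-identityʳ; ∧-assoc; T-≡)
open import Data.Empty using (⊥; ⊥-elim)
open import Data.Integer using (ℤ) renaming (+_ to pos; _+_ to _+ℤ_; _*_ to _*ℤ_; _-_ to _-ℤ_)
open import Data.Integer.Properties using (+-identityˡ; pos-+; pos-*)
open import Data.Integer.Tactic.RingSolver using () renaming (solve-∀ to solve-∀-ℤ)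
open import Data.List using (List; []; _∷_; _++_; map; concatMap; replicate; length; upTo; applyUpTo; filter; filterᵇ; drop)
open import Data.List.Properties as List using ()
open import Data.List.Membership.Propositional using (_∈_; find; lose)
open import Data.List.Membership.Propositional.Properties
  using (∈-map⁺; ∈-map⁻; ∈-concatMap⁺; ∈-concatMap⁻; ∈-upTo⁺; ∈-upTo⁻; ∈-filter⁺; ∈-filter⁻)
open import Data.List.Membership.Propositional.Properties.WithK using (unique∧set⇒bag)
open import Data.List.Relation.Binary.BagAndSetEquality using (∼bag⇒↭)
open import Data.List.Relation.Binary.Permutation.Propositional
  using (_↭_; prep; swap; ↭-sym; ↭-reflexive; module PermutationReasoning)
  renaming (refl to ↭-refl; trans to ↭-trans)
open import Data.List.Relation.Binary.Permutation.Propositional.Properties using (drop-∷; shift; map⁺; All-resp-↭)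
open import Data.List.Relation.Unary.All as All using (All; []; _∷_)
open import Data.List.Relation.Unary.All.Properties as All using ()
open import Data.List.Relation.Unary.AllPairs using ([]; _∷_)
open import Data.List.Relation.Unary.Any using (here; there)
open import Data.List.Relation.Unary.Unique.Propositional using (Unique)
open import Data.List.Relation.Unary.Unique.Propositional.Properties as Unique using ()
open import Data.Nat using (ℕ; zero; suc; _+_; _*_; _∸_; _≤_; _<_; _≥_; z≤n; s≤s; _≡ᵇ_; _<ᵇ_; _<?_; _≤?_; pred)
open import Data.Nat.Properties as ℕ using ()
open import Data.Nat.Tactic.RingSolver using (solve-∀)
open import Algebra.Properties.CommutativeSemigroup ℕ.+-commutativeSemigroup using (x∙yz≈y∙xz)
open import Data.Product using (_×_; _,_; ∃; ∃₂; proj₁; proj₂)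
open import Function using (_∘_; id; _⇔_; mk⇔; Equivalence)
open import Relation.Nullary using (yes; no)
open import Relation.Binary.PropositionalEquality
  using (_≡_; _≢_; refl; sym; trans; cong; cong₂; subst; _→-setoid_; module ≡-Reasoning)
import Relation.Binary.Reasoning.Setoid as SetoidReasoning

module ≈ₚ-Reasoning = SetoidReasoning (ℕ →-setoid ℤ)

private
  variable
    A B : Set

-- Formal power series

infixl 6 _⊕_
infixr 7 _·_

_⊕_ : PS → PS → PS
(f ⊕ g) k = f k +ℤ g k

_·_ : ℤ → PS → PS
(c · f) k = c *ℤ f k

⊕-cong : ∀ {f f′ g g′} → f ≈ₚ f′ → g ≈ₚ g′ → f ⊕ g ≈ₚ f′ ⊕ g′
⊕-cong p q k = cong₂ _+ℤ_ (p k) (q k)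

shiftT-cong : ∀ {f g} → f ≈ₚ g → shiftT f ≈ₚ shiftT g
shiftT-cong p zero    = refl
shiftT-cong p (suc k) = p k

deriv-cong : ∀ {f g} → f ≈ₚ g → deriv f ≈ₚ deriv g
deriv-cong p k = cong (pos (suc k) *ℤ_) (p (suc k))

divOneMinus-cong : ∀ {f g} → f ≈ₚ g → divOneMinus f ≈ₚ divOneMinus g
divOneMinus-cong p zero    = p zero
divOneMinus-cong p (suc k) = cong₂ _+ℤ_ (divOneMinus-cong p k) (p (suc k))

mulOneMinus-cong : ∀ {f g} → f ≈ₚ g → mulOneMinus f ≈ₚ mulOneMinus g
mulOneMinus-cong p zero    = p zero
mulOneMinus-cong p (suc k) = cong₂ _-ℤ_ (p (suc k)) (p k)

iter-cong : ∀ {h} → (∀ {f g} → f ≈ₚ g → h f ≈ₚ h g) →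
            ∀ j {f g} → f ≈ₚ g → iter j h f ≈ₚ iter j h g
iter-cong h-cong zero    p = p
iter-cong h-cong (suc j) p = h-cong (iter-cong h-cong j p)

iter-suc : ∀ j h (f : PS) → iter (suc j) h f ≡ iter j h (h f)
iter-suc zero    h f = refl
iter-suc (suc j) h f = cong h (iter-suc j h f)

iter-+ : ∀ i j h (f : PS) → iter i h (iter j h f) ≡ iter (i + j) h f
iter-+ zero    j h f = refl
iter-+ (suc i) j h f = cong h (iter-+ i j h f)

divPow-cong : ∀ j {f g} → f ≈ₚ g → divPow j f ≈ₚ divPow j g
divPow-cong = iter-cong divOneMinus-cong

mulPow-cong : ∀ j {f g} → f ≈ₚ g → mulPow j f ≈ₚ mulPow j g
mulPow-cong = iter-cong mulOneMinus-cong

mulOneMinus-divOneMinus : ∀ f → mulOneMinus (divOneMinus f) ≈ₚ f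
mulOneMinus-divOneMinus f zero    = refl
mulOneMinus-divOneMinus f (suc k) = cancel (divOneMinus f k) (f (suc k))
  where
  cancel : ∀ a b → (a +ℤ b) -ℤ a ≡ b
  cancel = solve-∀-ℤ

divOneMinus-mulOneMinus : ∀ f → divOneMinus (mulOneMinus f) ≈ₚ f
divOneMinus-mulOneMinus f zero    = refl
divOneMinus-mulOneMinus f (suc k) =
  trans (cong (_+ℤ (f (suc k) -ℤ f k)) (divOneMinus-mulOneMinus f k)) (cancel (f k) (f (suc k)))
  where
  cancel : ∀ a b → a +ℤ (b -ℤ a) ≡ b
  cancel = solve-∀-ℤ

mulPow-divPow : ∀ j f → mulPow j (divPow j f) ≈ₚ f
mulPow-divPow zero    f = λ _ → refl
mulPow-divPow (suc j) f = begin
  mulPow (suc j) (divPow (suc j) f)            ≡⟨ iter-suc j mulOneMinus _ ⟩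
  mulPow j (mulOneMinus (divOneMinus (divPow j f))) ≈⟨ mulPow-cong j (mulOneMinus-divOneMinus _) ⟩
  mulPow j (divPow j f)                        ≈⟨ mulPow-divPow j f ⟩
  f                                            ∎
  where open ≈ₚ-Reasoning

divOneMinus-⊕ : ∀ f g → divOneMinus (f ⊕ g) ≈ₚ divOneMinus f ⊕ divOneMinus g
divOneMinus-⊕ f g zero    = refl
divOneMinus-⊕ f g (suc k) =
  trans (cong (_+ℤ (f (suc k) +ℤ g (suc k))) (divOneMinus-⊕ f g k))
        (interchange (divOneMinus f k) (divOneMinus g k) (f (suc k)) (g (suc k)))
  where
  interchange : ∀ a b c d → (a +ℤ b) +ℤ (c +ℤ d) ≡ (a +ℤ c) +ℤ (b +ℤ d)
  interchange = solve-∀-ℤ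

divPow-⊕ : ∀ j f g → divPow j (f ⊕ g) ≈ₚ divPow j f ⊕ divPow j g
divPow-⊕ zero    f g = λ _ → refl
divPow-⊕ (suc j) f g = begin
  divOneMinus (divPow j (f ⊕ g))                 ≈⟨ divOneMinus-cong (divPow-⊕ j f g) ⟩
  divOneMinus (divPow j f ⊕ divPow j g)          ≈⟨ divOneMinus-⊕ (divPow j f) (divPow j g) ⟩
  divOneMinus (divPow j f) ⊕ divOneMinus (divPow j g) ∎
  where open ≈ₚ-Reasoning

shiftT-divOneMinus : ∀ f → shiftT (divOneMinus f) ≈ₚ divOneMinus (shiftT f)
shiftT-divOneMinus f zero          = refl
shiftT-divOneMinus f (suc zero)    = sym (+-identityˡ (f 0))
shiftT-divOneMinus f (suc (suc k)) = cong (_+ℤ f (suc k)) (shiftT-divOneMinus f (suc k))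

shiftT-divPow : ∀ j f → shiftT (divPow j f) ≈ₚ divPow j (shiftT f)
shiftT-divPow zero    f = λ _ → refl
shiftT-divPow (suc j) f = begin
  shiftT (divOneMinus (divPow j f)) ≈⟨ shiftT-divOneMinus (divPow j f) ⟩
  divOneMinus (shiftT (divPow j f)) ≈⟨ divOneMinus-cong (shiftT-divPow j f) ⟩
  divOneMinus (divPow j (shiftT f)) ∎
  where open ≈ₚ-Reasoning

deriv-divOneMinus : ∀ h → deriv (divOneMinus h) ≈ₚ divOneMinus (deriv h ⊕ divOneMinus h)
deriv-divOneMinus h zero    = base (h 0) (h 1)
  where
  base : ∀ a b → pos 1 *ℤ (a +ℤ b) ≡ pos 1 *ℤ b +ℤ a
  base = solve-∀-ℤ
deriv-divOneMinus h (suc k) =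
  trans (step (pos (suc k)) (divOneMinus h (suc k)) (h (suc (suc k))))
        (cong (_+ℤ (deriv h (suc k) +ℤ divOneMinus h (suc k))) (deriv-divOneMinus h k))
  where
  step : ∀ x D y → (pos 1 +ℤ x) *ℤ (D +ℤ y) ≡ x *ℤ D +ℤ ((pos 1 +ℤ x) *ℤ y +ℤ D)
  step = solve-∀-ℤ

quotientNumerator : ℕ → PS → PS
quotientNumerator N g = mulOneMinus (deriv g) ⊕ pos N · g

deriv-divPow : ∀ N g → deriv (divPow N g) ≈ₚ divPow (suc N) (quotientNumerator N g)
deriv-divPow zero g = begin
  deriv g                                            ≈⟨ divOneMinus-mulOneMinus (deriv g) ⟨
  divOneMinus (mulOneMinus (deriv g))                ≈⟨ divOneMinus-cong (λ k → plus-zero (mulOneMinus (deriv g) k) (g k)) ⟩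
  divOneMinus (quotientNumerator 0 g)                ∎
  where
  open ≈ₚ-Reasoning
  plus-zero : ∀ a b → a ≡ a +ℤ pos 0 *ℤ b
  plus-zero = solve-∀-ℤ
deriv-divPow (suc N) g = begin
  deriv (divOneMinus G)                              ≈⟨ deriv-divOneMinus G ⟩
  divOneMinus (deriv G ⊕ divOneMinus G)              ≈⟨ divOneMinus-cong (⊕-cong (deriv-divPow N g) (λ _ → refl)) ⟩
  divOneMinus (divPow (suc N) Q ⊕ divPow (suc N) g)  ≈⟨ divOneMinus-cong (divPow-⊕ (suc N) Q g) ⟨
  divOneMinus (divPow (suc N) (Q ⊕ g))               ≈⟨ divOneMinus-cong (divPow-cong (suc N) one-more) ⟩
  divOneMinus (divPow (suc N) (quotientNumerator (suc N) g)) ∎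
  where
  open ≈ₚ-Reasoning
  G Q : PS
  G = divPow N g
  Q = quotientNumerator N g
  one-more : Q ⊕ g ≈ₚ quotientNumerator (suc N) g
  one-more k = collect (mulOneMinus (deriv g) k) (pos N) (g k)
    where
    collect : ∀ a n b → (a +ℤ n *ℤ b) +ℤ b ≡ a +ℤ (pos 1 +ℤ n) *ℤ b
    collect = solve-∀-ℤ

𝟙 : Bool → ℕ
𝟙 b = if b then 1 else 0

∧-≡-true⁻ : ∀ {a b} → a ∧ b ≡ true → a ≡ true × b ≡ true
∧-≡-true⁻ {true} {true} _ = refl , refl

≡ᵇ-refl : ∀ a → (a ≡ᵇ a) ≡ true
≡ᵇ-refl zero    = refl
≡ᵇ-refl (suc a) = ≡ᵇ-refl a

≡ᵇ-true⇒≡ : ∀ {a b} → (a ≡ᵇ b) ≡ true → a ≡ b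
≡ᵇ-true⇒≡ {a} {b} eq = ℕ.≡ᵇ⇒≡ a b (subst Bool.T (sym eq) _)

≢⇒≡ᵇ-false : ∀ {a b} → a ≢ b → (a ≡ᵇ b) ≡ false
≢⇒≡ᵇ-false {a} {b} a≢b with a ≡ᵇ b in eq
... | true  = ⊥-elim (a≢b (≡ᵇ-true⇒≡ eq))
... | false = refl

𝟙-≡ᵇ-subst : ∀ d e (f : ℕ → ℕ) → 𝟙 (d ≡ᵇ e) * f d ≡ 𝟙 (d ≡ᵇ e) * f e
𝟙-≡ᵇ-subst d e f with d ≡ᵇ e in eq
... | true  = cong (λ x → 1 * f x) (≡ᵇ-true⇒≡ eq)
... | false = refl

countB-++ : (p : A → Bool) (xs ys : List A) → countB p (xs ++ ys) ≡ countB p xs + countB p ys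
countB-++ p []       ys = refl
countB-++ p (x ∷ xs) ys = trans (cong (𝟙 (p x) +_) (countB-++ p xs ys)) (sym (ℕ.+-assoc (𝟙 (p x)) _ _))

countB-↭ : (p : A → Bool) {xs ys : List A} → xs ↭ ys → countB p xs ≡ countB p ys
countB-↭ p ↭-refl        = refl
countB-↭ p (prep x r)    = cong (𝟙 (p x) +_) (countB-↭ p r)
countB-↭ p (swap x y r)  =
  trans (cong (λ c → 𝟙 (p x) + (𝟙 (p y) + c)) (countB-↭ p r)) (x∙yz≈y∙xz (𝟙 (p x)) (𝟙 (p y)) _)
countB-↭ p (↭-trans r s) = trans (countB-↭ p r) (countB-↭ p s)

countB-cong : {p q : A → Bool} → (∀ x → p x ≡ q x) → (xs : List A) → countB p xs ≡ countB q xs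
countB-cong p≡q []       = refl
countB-cong p≡q (x ∷ xs) = cong₂ (λ b c → 𝟙 b + c) (p≡q x) (countB-cong p≡q xs)

countB-map : (p : B → Bool) (f : A → B) (xs : List A) → countB p (map f xs) ≡ countB (λ x → p (f x)) xs
countB-map p f []       = refl
countB-map p f (x ∷ xs) = cong (𝟙 (p (f x)) +_) (countB-map p f xs)

countB-∧ : (p q : A → Bool) (xs : List A) → countB (λ x → p x ∧ q x) xs ≡ countB q (filterᵇ p xs)
countB-∧ p q []       = refl
countB-∧ p q (x ∷ xs) with p x
... | true  = cong (𝟙 (q x) +_) (countB-∧ p q xs)
... | false = countB-∧ p q xs

countB-replicate : (p : A → Bool) (n : ℕ) (a : A) → countB p (replicate n a) ≡ 𝟙 (p a) * n
countB-replicate p zero    a = sym (ℕ.*-zeroʳ (𝟙 (p a)))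
countB-replicate p (suc n) a = trans (cong (𝟙 (p a) +_) (countB-replicate p n a)) (sym (ℕ.*-suc (𝟙 (p a)) n))

countB-none : (p : A → Bool) (xs : List A) → (∀ {x} → x ∈ xs → p x ≡ false) → countB p xs ≡ 0
countB-none p []       none = refl
countB-none p (x ∷ xs) none rewrite none (here refl) = countB-none p xs (none ∘ there)

countB-concatMap : (p : B → Bool) (q r : A → Bool) (a c : ℕ) (f : A → List B) (xs : List A) →
                   (∀ {x} → x ∈ xs → countB p (f x) ≡ 𝟙 (q x) * a + 𝟙 (r x) * c) →
                   countB p (concatMap f xs) ≡ countB q xs * a + countB r xs * c
countB-concatMap p q r a c f []       each = refl
countB-concatMap p q r a c f (x ∷ xs) each = begin
  countB p (f x ++ concatMap f xs)                         ≡⟨ countB-++ p (f x) (concatMap f xs) ⟩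
  countB p (f x) + countB p (concatMap f xs)               ≡⟨ cong₂ _+_ (each (here refl))
                                                                 (countB-concatMap p q r a c f xs (each ∘ there)) ⟩
  (𝟙 (q x) * a + 𝟙 (r x) * c) + (countB q xs * a + countB r xs * c)
                                                           ≡⟨ regroup (𝟙 (q x)) (𝟙 (r x)) (countB q xs) (countB r xs) a c ⟩
  (𝟙 (q x) + countB q xs) * a + (𝟙 (r x) + countB r xs) * c ∎
  where
  open ≡-Reasoning
  regroup : ∀ i j Q R a c → (i * a + j * c) + (Q * a + R * c) ≡ (i + Q) * a + (j + R) * c
  regroup = solve-∀

Unique-concatMap⁺ : {f : A → List B} (g : B → A) {xs : List A} → Unique xs →
                    (∀ {x} → x ∈ xs → Unique (f x)) → (∀ {x y} → x ∈ xs → y ∈ f x → g y ≡ x) →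
                    Unique (concatMap f xs)
Unique-concatMap⁺ g {[]}     _          _      _   = []
Unique-concatMap⁺ {f = f} g {x ∷ xs} (x∉xs ∷ u) unique inv =
  Unique.++⁺ (unique (here refl)) (Unique-concatMap⁺ g u (unique ∘ there) (inv ∘ there)) disjoint
  where
  disjoint : ∀ {y} → y ∈ f x × y ∈ concatMap f xs → ⊥
  disjoint (y∈fx , y∈rest) with find (∈-concatMap⁻ f {xs = xs} y∈rest)
  ... | x′ , x′∈xs , y∈fx′ =
    All.lookup x∉xs x′∈xs (trans (sym (inv (here refl) y∈fx)) (inv (there x′∈xs) y∈fx′))

-- Inserting a block into a list

insertions : List A → List A → List (List A)
insertions b []      = (b ++ []) ∷ []
insertions b (a ∷ x) = (b ++ a ∷ x) ∷ map (a ∷_) (insertions b x)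

∈-insertions⁺ : (b u v : List A) → u ++ b ++ v ∈ insertions b (u ++ v)
∈-insertions⁺ b []      []      = here refl
∈-insertions⁺ b []      (a ∷ v) = here refl
∈-insertions⁺ b (a ∷ u) v       = there (∈-map⁺ (a ∷_) (∈-insertions⁺ b u v))

∈-insertions⁻ : (b x : List A) {y : List A} → y ∈ insertions b x →
                ∃₂ λ u v → x ≡ u ++ v × y ≡ u ++ b ++ v
∈-insertions⁻ b []      (here refl) = [] , [] , refl , refl
∈-insertions⁻ b (a ∷ x) (here refl) = [] , a ∷ x , refl , refl
∈-insertions⁻ b (a ∷ x) (there y∈)  with ∈-map⁻ (a ∷_) y∈
... | y′ , y′∈ , refl with ∈-insertions⁻ b x y′∈
...   | u , v , refl , refl = a ∷ u , v , refl , refl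

insertions-unique : {c : A} (b x : List A) → All (c ≢_) x → Unique (insertions (c ∷ b) x)
insertions-unique b []      []         = [] ∷ []
insertions-unique b (a ∷ x) (c≢a ∷ cx) =
  All.tabulate head-differs ∷ Unique.map⁺ List.∷-injectiveʳ (insertions-unique b x cx)
  where
  head-differs : ∀ {z} → z ∈ map (a ∷_) (insertions (_ ∷ b) x) → _ ∷ b ++ a ∷ x ≢ z
  head-differs z∈ eq with ∈-map⁻ (a ∷_) z∈
  ... | _ , _ , refl = c≢a (List.∷-injectiveˡ eq)

length-insert : (b u v : List A) → length (u ++ b ++ v) ≡ length b + length (u ++ v)
length-insert b u v = begin
  length (u ++ b ++ v)               ≡⟨ List.length-++ u ⟩
  length u + length (b ++ v)         ≡⟨ cong (length u +_) (List.length-++ b) ⟩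
  length u + (length b + length v)   ≡⟨ x∙yz≈y∙xz (length u) (length b) (length v) ⟩
  length b + (length u + length v)   ≡⟨ cong (length b +_) (List.length-++ u) ⟨
  length b + length (u ++ v)         ∎
  where open ≡-Reasoning

All-insert⁺ : ∀ {P : A → Set} b u v → All P b → All P (u ++ v) → All P (u ++ b ++ v)
All-insert⁺ b u v Pb Puv with All.++⁻ u Puv
... | Pu , Pv = All.++⁺ Pu (All.++⁺ Pb Pv)

All-insert⁻ : ∀ {P : A → Set} b u v → All P (u ++ b ++ v) → All P (u ++ v)
All-insert⁻ b u v Pubv with All.++⁻ u Pubv
... | Pu , Pbv = All.++⁺ Pu (All.++⁻ʳ b Pbv)

letters : ℕ → List ℕ
letters n = map suc (upTo n)

∈-letters⁺ : ∀ {a n} → 1 ≤ a → a ≤ n → a ∈ letters n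
∈-letters⁺ {suc a} (s≤s z≤n) a<n = ∈-map⁺ suc (∈-upTo⁺ a<n)

∈-letters⁻ : ∀ {a n} → a ∈ letters n → 1 ≤ a × a ≤ n
∈-letters⁻ a∈ with ∈-map⁻ suc a∈
... | _ , j∈ , refl = s≤s z≤n , ∈-upTo⁻ j∈

suc-∈-letters : ∀ {a n} → 1 ≤ a → suc a ∈ letters (suc n) ⇔ a ∈ letters n
suc-∈-letters a≥1 = mk⇔ (λ a∈ → ∈-letters⁺ a≥1 (ℕ.≤-pred (proj₂ (∈-letters⁻ a∈))))
                        (λ a∈ → ∈-letters⁺ (s≤s z≤n) (s≤s (proj₂ (∈-letters⁻ a∈))))

∈-words⁺ : ∀ L n {z} → length z ≡ L → All (_∈ letters n) z → z ∈ words L n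
∈-words⁺ zero    n {[]}    refl []         = here refl
∈-words⁺ (suc L) n {a ∷ z} eq   (a∈ ∷ z∈) =
  ∈-concatMap⁺ (λ w → map (_∷ w) (letters n)) {xs = words L n}
    (lose (∈-words⁺ L n (ℕ.suc-injective eq) z∈) (∈-map⁺ (_∷ z) a∈))

∈-words⁻ : ∀ L n {z} → z ∈ words L n → length z ≡ L × All (_∈ letters n) z
∈-words⁻ zero    n (here refl) = refl , []
∈-words⁻ (suc L) n z∈ with find (∈-concatMap⁻ (λ w → map (_∷ w) (letters n)) {xs = words L n} z∈)
... | w , w∈ , z∈′ with ∈-map⁻ (_∷ w) z∈′ | ∈-words⁻ L n w∈
...   | a , a∈ , refl | len , w-letters = cong suc len , a∈ ∷ w-letters

words-unique : ∀ L n → Unique (words L n)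
words-unique zero    n = [] ∷ []
words-unique (suc L) n =
  Unique-concatMap⁺ (drop 1) (words-unique L n)
    (λ _ → Unique.map⁺ List.∷-injectiveˡ (Unique.map⁺ ℕ.suc-injective (Unique.upTo⁺ n)))
    tail-inverse
  where
  tail-inverse : ∀ {w z} → w ∈ words L n → z ∈ map (_∷ w) (letters n) → drop 1 z ≡ w
  tail-inverse {w} _ z∈ with ∈-map⁻ (_∷ w) z∈
  ... | _ , _ , refl = refl

map-suc-positive : ∀ {w} → All (1 ≤_) w → All (1 <_) (map suc w)
map-suc-positive w≥1 = All.map⁺ (All.map s≤s w≥1)

map-suc-pred : ∀ {x} → All (1 ≤_) x → map suc (map pred x) ≡ x
map-suc-pred {x} x≥1 = trans (sym (List.map-∘ x)) (List.map-id-local (All.map (λ { (s≤s z≤n) → refl }) x≥1))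

-- Letter counts and the Stirling condition

allB-map : (p : ℕ → Bool) (f : ℕ → ℕ) (xs : List ℕ) → allB p (map f xs) ≡ allB (λ x → p (f x)) xs
allB-map p f []       = refl
allB-map p f (x ∷ xs) = cong (p (f x) ∧_) (allB-map p f xs)

allB-cong : {p q : ℕ → Bool} → (∀ x → p x ≡ q x) → (xs : List ℕ) → allB p xs ≡ allB q xs
allB-cong p≡q []       = refl
allB-cong p≡q (x ∷ xs) = cong₂ _∧_ (p≡q x) (allB-cong p≡q xs)

occ≡countB : ∀ i xs → occ i xs ≡ countB (_≡ᵇ i) xs
occ≡countB i []       = refl
occ≡countB i (x ∷ xs) = cong (𝟙 (x ≡ᵇ i) +_) (occ≡countB i xs)

occ-++ : ∀ i xs ys → occ i (xs ++ ys) ≡ occ i xs + occ i ys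
occ-++ i xs ys = begin
  occ i (xs ++ ys)                         ≡⟨ occ≡countB i (xs ++ ys) ⟩
  countB (_≡ᵇ i) (xs ++ ys)                ≡⟨ countB-++ (_≡ᵇ i) xs ys ⟩
  countB (_≡ᵇ i) xs + countB (_≡ᵇ i) ys    ≡⟨ cong₂ _+_ (occ≡countB i xs) (occ≡countB i ys) ⟨
  occ i xs + occ i ys                      ∎
  where open ≡-Reasoning

occ-insert : ∀ i b u v → occ i (u ++ b ++ v) ≡ occ i b + occ i (u ++ v)
occ-insert i b u v = begin
  occ i (u ++ b ++ v)                ≡⟨ occ-++ i u (b ++ v) ⟩
  occ i u + occ i (b ++ v)           ≡⟨ cong (occ i u +_) (occ-++ i b v) ⟩
  occ i u + (occ i b + occ i v)      ≡⟨ x∙yz≈y∙xz (occ i u) (occ i b) (occ i v) ⟩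
  occ i b + (occ i u + occ i v)      ≡⟨ cong (occ i b +_) (occ-++ i u v) ⟨
  occ i b + occ i (u ++ v)           ∎
  where open ≡-Reasoning

occ-replicate : ∀ i k a → occ i (replicate k a) ≡ 𝟙 (a ≡ᵇ i) * k
occ-replicate i k a = trans (occ≡countB i (replicate k a)) (countB-replicate (_≡ᵇ i) k a)

occ-map-suc : ∀ i w → occ (suc i) (map suc w) ≡ occ i w
occ-map-suc i []      = refl
occ-map-suc i (x ∷ w) = cong (𝟙 (x ≡ᵇ i) +_) (occ-map-suc i w)

occ-absent : ∀ i xs → All (_≢ i) xs → occ i xs ≡ 0
occ-absent i []       []           = refl
occ-absent i (x ∷ xs) (x≢i ∷ rest) rewrite ≢⇒≡ᵇ-false x≢i = occ-absent i xs rest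

isMultiset-suc : ∀ m n y → isMultiset m (suc n) y ≡ (occ 1 y ≡ᵇ m) ∧ allB (λ i → occ (suc (suc i)) y ≡ᵇ m) (upTo n)
isMultiset-suc m n y = cong ((occ 1 y ≡ᵇ m) ∧_) (begin
  allB P (map suc (applyUpTo suc n))        ≡⟨ cong (allB P ∘ map suc) (List.map-applyUpTo id suc n) ⟨
  allB P (map suc (map suc (upTo n)))       ≡⟨ allB-map P suc (map suc (upTo n)) ⟩
  allB (P ∘ suc) (map suc (upTo n))         ≡⟨ allB-map (P ∘ suc) suc (upTo n) ⟩
  allB (P ∘ suc ∘ suc) (upTo n)             ∎)
  where
  open ≡-Reasoning
  P : ℕ → Bool
  P i = occ i y ≡ᵇ m

isMultiset-insert : ∀ m n w u v → All (1 ≤_) w → u ++ v ≡ map suc w →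
                    isMultiset m (suc n) (u ++ replicate m 1 ++ v) ≡ isMultiset m n w
isMultiset-insert m n w u v w≥1 u++v≡ = begin
  isMultiset m (suc n) y                                            ≡⟨ isMultiset-suc m n y ⟩
  (occ 1 y ≡ᵇ m) ∧ allB (λ i → occ (suc (suc i)) y ≡ᵇ m) (upTo n)
      ≡⟨ cong₂ _∧_ ones-counted (allB-cong (cong (_≡ᵇ m) ∘ occ-shifted ∘ suc) (upTo n)) ⟩
  true ∧ allB (λ i → occ (suc i) w ≡ᵇ m) (upTo n)                   ≡⟨ allB-map (λ i → occ i w ≡ᵇ m) suc (upTo n) ⟨
  isMultiset m n w                                                  ∎
  where
  open ≡-Reasoning
  y : List ℕ
  y = u ++ replicate m 1 ++ v
  occ-shifted : ∀ i → occ (suc i) y ≡ 𝟙 (1 ≡ᵇ suc i) * m + occ i w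
  occ-shifted i = begin
    occ (suc i) y                                        ≡⟨ occ-insert (suc i) (replicate m 1) u v ⟩
    occ (suc i) (replicate m 1) + occ (suc i) (u ++ v)   ≡⟨ cong₂ _+_ (occ-replicate (suc i) m 1) (cong (occ (suc i)) u++v≡) ⟩
    𝟙 (1 ≡ᵇ suc i) * m + occ (suc i) (map suc w)         ≡⟨ cong (𝟙 (1 ≡ᵇ suc i) * m +_) (occ-map-suc i w) ⟩
    𝟙 (1 ≡ᵇ suc i) * m + occ i w                         ∎
  ones-counted : (occ 1 y ≡ᵇ m) ≡ true
  ones-counted = subst (λ c → (c ≡ᵇ m) ≡ true) (sym (begin
    occ 1 y             ≡⟨ occ-shifted 0 ⟩
    1 * m + occ 0 w     ≡⟨ cong₂ _+_ (ℕ.*-identityˡ m) (occ-absent 0 w (All.map (λ { (s≤s _) () }) w≥1)) ⟩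
    m + 0               ≡⟨ ℕ.+-identityʳ m ⟩
    m                   ∎)) (≡ᵇ-refl m)

checkFrom-insert-ones : ∀ {x} → 1 < x → ∀ bad u k v →
                        checkFrom x bad (u ++ replicate k 1 ++ v) ≡ checkFrom x bad (u ++ v)
checkFrom-insert-ones (s≤s (s≤s z≤n)) bad [] zero    v = refl
checkFrom-insert-ones (s≤s (s≤s z≤n)) bad [] (suc k) v
  rewrite ∨-identityʳ bad = checkFrom-insert-ones (s≤s (s≤s z≤n)) bad [] k v
checkFrom-insert-ones {x} x>1 bad (a ∷ u) k v =
  cong ((if a ≡ᵇ x then not bad else true) ∧_) (checkFrom-insert-ones x>1 (bad ∨ (x <ᵇ a)) u k v)

checkFrom-1-absent : ∀ bad v → All (1 <_) v → checkFrom 1 bad v ≡ true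
checkFrom-1-absent bad []                 []                      = refl
checkFrom-1-absent bad (suc (suc c) ∷ v) (s≤s (s≤s z≤n) ∷ v>1) = checkFrom-1-absent _ v v>1

checkFrom-1-ones : ∀ k v → All (1 <_) v → checkFrom 1 false (replicate k 1 ++ v) ≡ true
checkFrom-1-ones zero    v v>1 = checkFrom-1-absent false v v>1
checkFrom-1-ones (suc k) v v>1 = checkFrom-1-ones k v v>1

stirling-insert-ones : ∀ u k v → All (1 <_) (u ++ v) → stirling (u ++ replicate k 1 ++ v) ≡ stirling (u ++ v)
stirling-insert-ones [] zero    v v>1 = refl
stirling-insert-ones [] (suc k) v v>1
  rewrite checkFrom-1-ones k v v>1 = stirling-insert-ones [] k v v>1
stirling-insert-ones (a ∷ u) k v (a>1 ∷ uv>1) =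
  cong₂ _∧_ (checkFrom-insert-ones a>1 false u k v) (stirling-insert-ones u k v uv>1)

checkFrom-map-suc : ∀ x bad w → checkFrom (suc x) bad (map suc w) ≡ checkFrom x bad w
checkFrom-map-suc x bad []      = refl
checkFrom-map-suc x bad (y ∷ w) = cong ((if y ≡ᵇ x then not bad else true) ∧_) (checkFrom-map-suc x _ w)

stirling-map-suc : ∀ w → stirling (map suc w) ≡ stirling w
stirling-map-suc []      = refl
stirling-map-suc (x ∷ w) = cong₂ _∧_ (checkFrom-map-suc x false w) (stirling-map-suc w)

ones-prefix : ∀ y → All (1 ≤_) y → checkFrom 1 false y ≡ true →
              ∃₂ λ j v → y ≡ replicate j 1 ++ v × All (1 <_) v
ones-prefix []                _            _  = 0 , [] , refl , []
ones-prefix (suc zero ∷ y)    (_ ∷ y≥1)    ok with ones-prefix y y≥1 ok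
... | j , v , refl , v>1 = suc j , v , refl , v>1
ones-prefix (suc (suc c) ∷ y) (_ ∷ y≥1)    ok = 0 , _ , refl , s≤s (s≤s z≤n) ∷ no-ones y y≥1 ok
  where
  no-ones : ∀ z → All (1 ≤_) z → checkFrom 1 true z ≡ true → All (1 <_) z
  no-ones []                _          _  = []
  no-ones (zero ∷ z)        (() ∷ _)   _
  no-ones (suc zero ∷ z)    _          ()
  no-ones (suc (suc c) ∷ z) (_ ∷ z≥1) ok = s≤s (s≤s z≤n) ∷ no-ones z z≥1 ok

ones-contiguous : ∀ y → All (1 ≤_) y → stirling y ≡ true →
                  ∃₂ λ u v → y ≡ u ++ replicate (occ 1 y) 1 ++ v × All (1 <_) (u ++ v)
ones-contiguous []                _            _ = [] , [] , refl , []
ones-contiguous (suc zero ∷ y)    (_ ∷ y≥1)    st with ones-prefix y y≥1 (proj₁ (∧-≡-true⁻ st))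
... | j , v , refl , v>1 = [] , v , cong (λ c → replicate (suc c) 1 ++ v) (sym ones-counted) , v>1
  where
  ones-counted : occ 1 (replicate j 1 ++ v) ≡ j
  ones-counted = begin
    occ 1 (replicate j 1 ++ v)          ≡⟨ occ-++ 1 (replicate j 1) v ⟩
    occ 1 (replicate j 1) + occ 1 v     ≡⟨ cong₂ _+_ (occ-replicate 1 j 1)
                                                     (occ-absent 1 v (All.map (λ { (s≤s (s≤s _)) () }) v>1)) ⟩
    1 * j + 0                           ≡⟨ ℕ.+-identityʳ (1 * j) ⟩
    1 * j                               ≡⟨ ℕ.*-identityˡ j ⟩
    j                                   ∎
    where open ≡-Reasoning
ones-contiguous (suc (suc a) ∷ y) (_ ∷ y≥1)    st
  with ones-contiguous y y≥1 (proj₂ (∧-≡-true⁻ {checkFrom (suc (suc a)) false y} st))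
... | u , v , y≡ , uv>1 = suc (suc a) ∷ u , v , cong (suc (suc a) ∷_) y≡ , s≤s (s≤s z≤n) ∷ uv>1

-- Stirling permutations by insertion

isStirlingPerm : ℕ → ℕ → List ℕ → Bool
isStirlingPerm m n w = isMultiset m n w ∧ stirling w

isStirlingPerm-insert : ∀ m n w u v → All (1 ≤_) w → u ++ v ≡ map suc w →
                        isStirlingPerm m (suc n) (u ++ replicate m 1 ++ v) ≡ isStirlingPerm m n w
isStirlingPerm-insert m n w u v w≥1 u++v≡ = cong₂ _∧_ (isMultiset-insert m n w u v w≥1 u++v≡) (begin
  stirling (u ++ replicate m 1 ++ v) ≡⟨ stirling-insert-ones u m v (subst (All (1 <_)) (sym u++v≡) (map-suc-positive w≥1)) ⟩
  stirling (u ++ v)                  ≡⟨ cong stirling u++v≡ ⟩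
  stirling (map suc w)               ≡⟨ stirling-map-suc w ⟩
  stirling w                         ∎)
  where open ≡-Reasoning

words-insert : ∀ m n w u v → All (1 ≤_) w → u ++ v ≡ map suc w →
               (u ++ replicate m 1 ++ v ∈ words (m * suc n) (suc n)) ⇔ (w ∈ words (m * n) n)
words-insert m n w u v w≥1 u++v≡ = mk⇔ shrink grow
  where
  y : List ℕ
  y = u ++ replicate m 1 ++ v
  length-y : length y ≡ m + length w
  length-y = begin
    length y                      ≡⟨ length-insert (replicate m 1) u v ⟩
    length (replicate m 1) + length (u ++ v) ≡⟨ cong₂ _+_ (List.length-replicate m) (cong length u++v≡) ⟩
    m + length (map suc w)        ≡⟨ cong (m +_) (List.length-map suc w) ⟩
    m + length w                  ∎
    where open ≡-Reasoning
  shrink : y ∈ words (m * suc n) (suc n) → w ∈ words (m * n) n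
  shrink y∈ with ∈-words⁻ (m * suc n) (suc n) y∈
  ... | len , y-letters =
    ∈-words⁺ (m * n) n (ℕ.+-cancelˡ-≡ m _ _ (trans (sym length-y) (trans len (ℕ.*-suc m n))))
      (All.zipWith (λ (a≥1 , sa∈) → Equivalence.to (suc-∈-letters a≥1) sa∈)
        (w≥1 , All.map⁻ (subst (All (_∈ letters (suc n))) u++v≡ (All-insert⁻ (replicate m 1) u v y-letters))))
  grow : w ∈ words (m * n) n → y ∈ words (m * suc n) (suc n)
  grow w∈ with ∈-words⁻ (m * n) n w∈
  ... | len , w-letters =
    ∈-words⁺ (m * suc n) (suc n) (trans length-y (trans (cong (m +_) len) (sym (ℕ.*-suc m n))))
      (All-insert⁺ (replicate m 1) u v (All.replicate⁺ m (∈-letters⁺ (s≤s z≤n) (s≤s z≤n)))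
        (subst (All (_∈ letters (suc n))) (sym u++v≡)
          (All.map⁺ (All.zipWith (λ (a≥1 , a∈) → Equivalence.from (suc-∈-letters a≥1) a∈) (w≥1 , w-letters)))))

stirlingWords : ℕ → ℕ → List (List ℕ)
stirlingWords m n = filterᵇ (isStirlingPerm m n) (words (m * n) n)

∈-stirlingWords⁺ : ∀ m n {w} → w ∈ words (m * n) n → isStirlingPerm m n w ≡ true → w ∈ stirlingWords m n
∈-stirlingWords⁺ m n w∈ ok = ∈-filter⁺ (Bool.T? ∘ isStirlingPerm m n) w∈ (Equivalence.from T-≡ ok)

∈-stirlingWords⁻ : ∀ m n {w} → w ∈ stirlingWords m n → w ∈ words (m * n) n × isStirlingPerm m n w ≡ true
∈-stirlingWords⁻ m n w∈ with ∈-filter⁻ (Bool.T? ∘ isStirlingPerm m n) {xs = words (m * n) n} w∈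
... | w∈′ , ok = w∈′ , Equivalence.to T-≡ ok

stirlingWords-positive : ∀ m n {w} → w ∈ stirlingWords m n → All (1 ≤_) w
stirlingWords-positive m n w∈ =
  All.map (proj₁ ∘ ∈-letters⁻) (proj₂ (∈-words⁻ (m * n) n (proj₁ (∈-stirlingWords⁻ m n w∈))))

stirlingWords-suc⁺ : ∀ m n {w y} → w ∈ stirlingWords m n → y ∈ insertions (replicate m 1) (map suc w) →
                     y ∈ stirlingWords m (suc n)
stirlingWords-suc⁺ m n {w} w∈ y∈ with ∈-insertions⁻ (replicate m 1) (map suc w) y∈ | ∈-stirlingWords⁻ m n w∈
... | u , v , w≡ , refl | w∈words , ok =
  ∈-stirlingWords⁺ m (suc n)
    (Equivalence.from (words-insert m n w u v w≥1 (sym w≡)) w∈words)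
    (trans (isStirlingPerm-insert m n w u v w≥1 (sym w≡)) ok)
  where
  w≥1 : All (1 ≤_) w
  w≥1 = stirlingWords-positive m n w∈

stirlingWords-ones-block : ∀ m n {y} → y ∈ stirlingWords m (suc n) →
                           ∃₂ λ u v → y ≡ u ++ replicate m 1 ++ v × All (1 <_) (u ++ v)
stirlingWords-ones-block m n {y} y∈ with ∈-stirlingWords⁻ m (suc n) y∈
... | _ , ok with ∧-≡-true⁻ {isMultiset m (suc n) y} ok
...   | multiset , st with ∧-≡-true⁻ {occ 1 y ≡ᵇ m} (trans (sym (isMultiset-suc m n y)) multiset)
...     | m-ones , _ with ones-contiguous y (stirlingWords-positive m (suc n) y∈) st
...       | u , v , y≡ , uv>1 = u , v , trans y≡ (cong (λ c → u ++ replicate c 1 ++ v) (≡ᵇ-true⇒≡ m-ones)) , uv>1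

stirlingWords-suc⁻ : ∀ m n {y} → y ∈ stirlingWords m (suc n) →
                     ∃ λ w → w ∈ stirlingWords m n × y ∈ insertions (replicate m 1) (map suc w)
stirlingWords-suc⁻ m n y∈ with stirlingWords-ones-block m n y∈ | ∈-stirlingWords⁻ m (suc n) y∈
... | u , v , refl , uv>1 | y∈words , ok =
  w , ∈-stirlingWords⁺ m n (Equivalence.to (words-insert m n w u v w≥1 u++v≡) y∈words)
                           (trans (sym (isStirlingPerm-insert m n w u v w≥1 u++v≡)) ok)
    , subst (λ x → u ++ replicate m 1 ++ v ∈ insertions (replicate m 1) x) u++v≡ (∈-insertions⁺ (replicate m 1) u v)
  where
  w : List ℕ
  w = map pred (u ++ v)
  w≥1 : All (1 ≤_) w
  w≥1 = All.map⁺ (All.map (λ { (s≤s 1≤a) → 1≤a }) uv>1)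
  u++v≡ : u ++ v ≡ map suc w
  u++v≡ = sym (map-suc-pred (All.map ℕ.<⇒≤ uv>1))

stirlingPerms : ℕ → ℕ → List (List ℕ)
stirlingPerms m zero    = [] ∷ []
stirlingPerms m (suc n) = concatMap (λ w → insertions (replicate m 1) (map suc w)) (stirlingPerms m n)

∈-stirlingPerms-suc⁻ : ∀ m n {y} → y ∈ stirlingPerms m (suc n) →
                       ∃ λ w → w ∈ stirlingPerms m n × y ∈ insertions (replicate m 1) (map suc w)
∈-stirlingPerms-suc⁻ m n = find ∘ ∈-concatMap⁻ (λ w → insertions (replicate m 1) (map suc w)) {xs = stirlingPerms m n}

∈-stirlingPerms : ∀ m n {w} → w ∈ stirlingPerms m n ⇔ w ∈ stirlingWords m n
∈-stirlingPerms m zero    rewrite ℕ.*-zeroʳ m = mk⇔ id id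
∈-stirlingPerms m (suc n) = mk⇔ to from
  where
  to : ∀ {y} → y ∈ stirlingPerms m (suc n) → y ∈ stirlingWords m (suc n)
  to y∈ with ∈-stirlingPerms-suc⁻ m n y∈
  ... | w , w∈ , y∈′ = stirlingWords-suc⁺ m n (Equivalence.to (∈-stirlingPerms m n) w∈) y∈′
  from : ∀ {y} → y ∈ stirlingWords m (suc n) → y ∈ stirlingPerms m (suc n)
  from y∈ with stirlingWords-suc⁻ m n y∈
  ... | w , w∈ , y∈′ =
    ∈-concatMap⁺ (λ w → insertions (replicate m 1) (map suc w)) {xs = stirlingPerms m n}
      (lose (Equivalence.from (∈-stirlingPerms m n) w∈) y∈′)

stirlingPerms-positive : ∀ m n {w} → w ∈ stirlingPerms m n → All (1 ≤_) w
stirlingPerms-positive m n = stirlingWords-positive m n ∘ Equivalence.to (∈-stirlingPerms m n)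

stirlingPerms-length : ∀ m n {w} → w ∈ stirlingPerms m n → length w ≡ m * n
stirlingPerms-length m n =
  proj₁ ∘ ∈-words⁻ (m * n) n ∘ proj₁ ∘ ∈-stirlingWords⁻ m n ∘ Equivalence.to (∈-stirlingPerms m n)

unshift : List ℕ → List ℕ
unshift y = map pred (filter (1 <?_) y)

unshift-insert : ∀ k w u v → All (1 ≤_) w → u ++ v ≡ map suc w → unshift (u ++ replicate k 1 ++ v) ≡ w
unshift-insert k w u v w≥1 u++v≡ = begin
  map pred (large (u ++ replicate k 1 ++ v))   ≡⟨ cong (map pred) ones-dropped ⟩
  map pred (u ++ v)                            ≡⟨ cong (map pred) u++v≡ ⟩
  map pred (map suc w)                         ≡⟨ List.map-∘ w ⟨
  map id w                                     ≡⟨ List.map-id w ⟩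
  w                                            ∎
  where
  open ≡-Reasoning
  large : List ℕ → List ℕ
  large = filter (1 <?_)
  uv>1 : All (1 <_) u × All (1 <_) v
  uv>1 = All.++⁻ u (subst (All (1 <_)) (sym u++v≡) (map-suc-positive w≥1))
  ones-dropped : large (u ++ replicate k 1 ++ v) ≡ u ++ v
  ones-dropped = begin
    large (u ++ replicate k 1 ++ v)              ≡⟨ List.filter-++ (1 <?_) u (replicate k 1 ++ v) ⟩
    large u ++ large (replicate k 1 ++ v)        ≡⟨ cong (large u ++_) (List.filter-++ (1 <?_) (replicate k 1) v) ⟩
    large u ++ large (replicate k 1) ++ large v  ≡⟨ cong₂ (λ r s → r ++ s ++ large v)
                                                          (List.filter-all (1 <?_) (proj₁ uv>1))
                                                          (List.filter-none (1 <?_) (All.replicate⁺ k (ℕ.<-irrefl refl))) ⟩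
    u ++ large v                                 ≡⟨ cong (u ++_) (List.filter-all (1 <?_) (proj₂ uv>1)) ⟩
    u ++ v                                       ∎

-- The block must be nonempty: for m = 0 all gaps give the same word.
stirlingPerms-unique : ∀ m n → Unique (stirlingPerms (suc m) n)
stirlingPerms-unique m zero    = [] ∷ []
stirlingPerms-unique m (suc n) =
  Unique-concatMap⁺ unshift (stirlingPerms-unique m n)
    (λ {w} w∈ → insertions-unique (replicate m 1) (map suc w)
                  (All.map ℕ.<⇒≢ (map-suc-positive (stirlingPerms-positive (suc m) n w∈))))
    (λ {w} w∈ y∈ → invert w (stirlingPerms-positive (suc m) n w∈) (∈-insertions⁻ (replicate (suc m) 1) (map suc w) y∈))
  where
  invert : ∀ w {y} → All (1 ≤_) w →
           ∃₂ (λ u v → map suc w ≡ u ++ v × y ≡ u ++ replicate (suc m) 1 ++ v) → unshift y ≡ w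
  invert w w≥1 (u , v , w≡ , refl) = unshift-insert (suc m) w u v w≥1 (sym w≡)

T≡countB-stirlingPerms : ∀ m n k → T (suc m) n k ≡ countB (λ w → des w ≡ᵇ k) (stirlingPerms (suc m) n)
T≡countB-stirlingPerms m n k = begin
  T (suc m) n k
    ≡⟨ countB-cong (λ w → sym (∧-assoc (isMultiset (suc m) n w) (stirling w) _)) (words (suc m * n) n) ⟩
  countB (λ w → isStirlingPerm (suc m) n w ∧ (des w ≡ᵇ k)) (words (suc m * n) n)
    ≡⟨ countB-∧ (isStirlingPerm (suc m) n) (λ w → des w ≡ᵇ k) (words (suc m * n) n) ⟩
  countB (λ w → des w ≡ᵇ k) (stirlingWords (suc m) n)
    ≡⟨ countB-↭ (λ w → des w ≡ᵇ k) stirlingWords↭stirlingPerms ⟩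
  countB (λ w → des w ≡ᵇ k) (stirlingPerms (suc m) n)
    ∎
  where
  open ≡-Reasoning
  stirlingWords↭stirlingPerms : stirlingWords (suc m) n ↭ stirlingPerms (suc m) n
  stirlingWords↭stirlingPerms = ∼bag⇒↭ (unique∧set⇒bag
    (Unique.filter⁺ (Bool.T? ∘ isStirlingPerm (suc m) n) (words-unique (suc m * n) n))
    (stirlingPerms-unique m n)
    (mk⇔ (Equivalence.from (∈-stirlingPerms (suc m) n)) (Equivalence.to (∈-stirlingPerms (suc m) n))))

-- Descents and the recurrence for T

des-map-suc : ∀ w → des (map suc w) ≡ des w
des-map-suc []          = refl
des-map-suc (x ∷ [])    = refl
des-map-suc (x ∷ y ∷ w) = cong (𝟙 (y <ᵇ x) +_) (des-map-suc (y ∷ w))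

des-1∷ : ∀ r → All (1 ≤_) r → des (1 ∷ r) ≡ des r
des-1∷ []          []       = refl
des-1∷ (suc c ∷ r) (_ ∷ _) = refl

des-ones-++ : ∀ k r → All (1 ≤_) r → des (replicate k 1 ++ r) ≡ des r
des-ones-++ zero    r r≥1 = refl
des-ones-++ (suc k) r r≥1 =
  trans (des-1∷ (replicate k 1 ++ r) (All.++⁺ (All.replicate⁺ k (s≤s z≤n)) r≥1)) (des-ones-++ k r r≥1)

des-∷-ones-++ : ∀ {a} → 1 < a → ∀ k r → All (1 ≤_) r → des (a ∷ replicate (suc k) 1 ++ r) ≡ suc (des r)
des-∷-ones-++ (s≤s (s≤s z≤n)) k r r≥1 = cong suc (des-ones-++ (suc k) r r≥1)

des-∷≤length : ∀ c r → des (c ∷ r) ≤ length r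
des-∷≤length c []      = z≤n
des-∷≤length c (e ∷ r) with e <ᵇ c
... | true  = s≤s (des-∷≤length e r)
... | false = ℕ.m≤n⇒m≤1+n (des-∷≤length e r)

-- The descent numbers of the insertions of a block of 1s into a word of length L with d
-- descents: d at the front and inside the d descents, d + 1 at the other L - d gaps.
descentProfile : ℕ → ℕ → List ℕ
descentProfile L d = replicate (suc d) d ++ replicate (L ∸ d) (suc d)

-- β records whether a new first letter forms a descent with the old one.
descentProfile-cons : ∀ β d L R → d ≤ L → d ∷ R ↭ descentProfile L d →
                      (𝟙 β + d) ∷ suc d ∷ map (𝟙 β +_) R ↭ descentProfile (suc L) (𝟙 β + d)
descentProfile-cons false d L R d≤L d∷R↭ = begin
  d ∷ suc d ∷ map id R                                      ≡⟨ cong (λ z → d ∷ suc d ∷ z) (List.map-id R) ⟩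
  d ∷ suc d ∷ R                                             ↭⟨ prep d (prep (suc d) (drop-∷ d∷R↭)) ⟩
  d ∷ suc d ∷ replicate d d ++ replicate (L ∸ d) (suc d)    ↭⟨ prep d (↭-sym (shift (suc d) (replicate d d) _)) ⟩
  d ∷ replicate d d ++ suc d ∷ replicate (L ∸ d) (suc d)
      ≡⟨ cong (λ j → d ∷ replicate d d ++ replicate j (suc d)) (ℕ.+-∸-assoc 1 d≤L) ⟨
  descentProfile (suc L) d                                  ∎
  where open PermutationReasoning
descentProfile-cons true d L R d≤L d∷R↭ = begin
  suc d ∷ suc d ∷ map suc R
      ↭⟨ prep (suc d) (prep (suc d) (map⁺ suc (drop-∷ d∷R↭))) ⟩
  suc d ∷ suc d ∷ map suc (replicate d d ++ replicate (L ∸ d) (suc d))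
      ≡⟨ cong (λ z → suc d ∷ suc d ∷ z) shifted ⟩
  descentProfile (suc L) (suc d)
      ∎
  where
  open PermutationReasoning
  shifted : map suc (replicate d d ++ replicate (L ∸ d) (suc d))
          ≡ replicate d (suc d) ++ replicate (L ∸ d) (suc (suc d))
  shifted = trans (List.map-++ suc (replicate d d) _)
                  (cong₂ _++_ (List.map-replicate suc d d) (List.map-replicate suc _ (suc d)))

des-∷-∷-map : ∀ a c (I : List (List ℕ)) →
              map des (map (a ∷_) (map (c ∷_) I)) ≡ map (𝟙 (c <ᵇ a) +_) (map des (map (c ∷_) I))
des-∷-∷-map a c []      = refl
des-∷-∷-map a c (y ∷ I) = cong (_ ∷_) (des-∷-∷-map a c I)

des-insertions↭ : ∀ k x → All (1 <_) x →
                  map des (insertions (1 ∷ replicate k 1) x) ↭ descentProfile (length x) (des x)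
des-insertions↭ k []          []         = ↭-reflexive (cong (_∷ []) (des-ones-++ (suc k) [] []))
des-insertions↭ k (a ∷ [])    (a>1 ∷ []) = ↭-reflexive
  (cong₂ (λ d e → d ∷ e ∷ []) (des-ones-++ (suc k) (a ∷ []) (ℕ.<⇒≤ a>1 ∷ [])) (des-∷-ones-++ a>1 k [] []))
des-insertions↭ k (a ∷ c ∷ x) (a>1 ∷ c>1 ∷ x>1) = begin
  des (b ++ a ∷ c ∷ x) ∷ des (a ∷ b ++ c ∷ x) ∷ map des (map (a ∷_) (map (c ∷_) I))
      ≡⟨ cong₂ (λ e f → e ∷ f ∷ map des (map (a ∷_) (map (c ∷_) I))) front-gap after-a ⟩
  (𝟙 (c <ᵇ a) + d) ∷ suc d ∷ map des (map (a ∷_) (map (c ∷_) I))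
      ≡⟨ cong (λ r → (𝟙 (c <ᵇ a) + d) ∷ suc d ∷ r) later-gaps ⟩
  (𝟙 (c <ᵇ a) + d) ∷ suc d ∷ map (𝟙 (c <ᵇ a) +_) R
      ↭⟨ descentProfile-cons (c <ᵇ a) d (length (c ∷ x)) R (ℕ.m≤n⇒m≤1+n (des-∷≤length c x))
           (↭-trans (↭-reflexive (cong (_∷ R) (sym tail-front-gap))) (des-insertions↭ k (c ∷ x) (c>1 ∷ x>1))) ⟩
  descentProfile (length (a ∷ c ∷ x)) (des (a ∷ c ∷ x)) ∎
  where
  open PermutationReasoning
  b : List ℕ
  b = 1 ∷ replicate k 1
  I : List (List ℕ)
  I = insertions b x
  R : List ℕ
  R = map des (map (c ∷_) I)
  d : ℕ
  d = des (c ∷ x)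
  cx≥1 : All (1 ≤_) (c ∷ x)
  cx≥1 = All.map ℕ.<⇒≤ (c>1 ∷ x>1)
  front-gap : des (b ++ a ∷ c ∷ x) ≡ 𝟙 (c <ᵇ a) + d
  front-gap = des-ones-++ (suc k) (a ∷ c ∷ x) (ℕ.<⇒≤ a>1 ∷ cx≥1)
  after-a : des (a ∷ b ++ c ∷ x) ≡ suc d
  after-a = des-∷-ones-++ a>1 k (c ∷ x) cx≥1
  later-gaps : map des (map (a ∷_) (map (c ∷_) I)) ≡ map (𝟙 (c <ᵇ a) +_) R
  later-gaps = des-∷-∷-map a c I
  tail-front-gap : des (b ++ c ∷ x) ≡ d
  tail-front-gap = des-ones-++ (suc k) (c ∷ x) cx≥1

countB-des-insertions : ∀ k x e → All (1 <_) x →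
  countB (λ y → des y ≡ᵇ e) (insertions (1 ∷ replicate k 1) x)
    ≡ 𝟙 (des x ≡ᵇ e) * suc (des x) + 𝟙 (suc (des x) ≡ᵇ e) * (length x ∸ des x)
countB-des-insertions k x e x>1 = begin
  countB (λ y → des y ≡ᵇ e) (insertions b x)                  ≡⟨ countB-map (_≡ᵇ e) des (insertions b x) ⟨
  countB (_≡ᵇ e) (map des (insertions b x))                   ≡⟨ countB-↭ (_≡ᵇ e) (des-insertions↭ k x x>1) ⟩
  countB (_≡ᵇ e) (descentProfile (length x) d)                ≡⟨ countB-++ (_≡ᵇ e) (replicate (suc d) d) _ ⟩
  countB (_≡ᵇ e) (replicate (suc d) d) + countB (_≡ᵇ e) (replicate (length x ∸ d) (suc d))
                                                              ≡⟨ cong₂ _+_ (countB-replicate (_≡ᵇ e) (suc d) d)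
                                                                           (countB-replicate (_≡ᵇ e) (length x ∸ d) (suc d)) ⟩
  𝟙 (d ≡ᵇ e) * suc d + 𝟙 (suc d ≡ᵇ e) * (length x ∸ d)        ∎
  where
  open ≡-Reasoning
  b : List ℕ
  b = 1 ∷ replicate k 1
  d : ℕ
  d = des x

des-insertions-≤ : ∀ k x → All (1 <_) x → All (λ y → des y ≤ suc (des x)) (insertions (1 ∷ replicate k 1) x)
des-insertions-≤ k x x>1 = All.map⁻ (All-resp-↭ {P = _≤ suc (des x)} (↭-sym (des-insertions↭ k x x>1))
  (All.++⁺ (All.replicate⁺ (suc (des x)) (ℕ.n≤1+n (des x))) (All.replicate⁺ (length x ∸ des x) ℕ.≤-refl)))

des-stirlingPerms-≤ : ∀ m n {w} → w ∈ stirlingPerms (suc m) (suc n) → des w ≤ n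
des-stirlingPerms-≤ m zero    (here refl) = ℕ.≤-reflexive (des-ones-++ (suc m) [] [])
des-stirlingPerms-≤ m (suc n) {y} y∈ with ∈-stirlingPerms-suc⁻ (suc m) (suc n) y∈
... | w , w∈ , y∈′ = begin
  des y                  ≤⟨ All.lookup (des-insertions-≤ m (map suc w) w>1) y∈′ ⟩
  suc (des (map suc w))  ≡⟨ cong suc (des-map-suc w) ⟩
  suc (des w)            ≤⟨ s≤s (des-stirlingPerms-≤ m n w∈) ⟩
  suc n                  ∎
  where
  open ℕ.≤-Reasoning
  w>1 : All (1 <_) (map suc w)
  w>1 = map-suc-positive (stirlingPerms-positive (suc m) (suc n) w∈)

countB-des-insertions-stirlingPerm : ∀ m n e {w} → w ∈ stirlingPerms (suc m) n →
  countB (λ y → des y ≡ᵇ e) (insertions (replicate (suc m) 1) (map suc w))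
    ≡ 𝟙 (des w ≡ᵇ e) * suc (des w) + 𝟙 (suc (des w) ≡ᵇ e) * (suc m * n ∸ des w)
countB-des-insertions-stirlingPerm m n e {w} w∈ =
  trans (countB-des-insertions m (map suc w) e (map-suc-positive (stirlingPerms-positive (suc m) n w∈)))
        (cong₂ (λ d L → 𝟙 (d ≡ᵇ e) * suc d + 𝟙 (suc d ≡ᵇ e) * (L ∸ d)) (des-map-suc w) length-w)
  where
  length-w : length (map suc w) ≡ suc m * n
  length-w = trans (List.length-map suc w) (stirlingPerms-length (suc m) n w∈)

T-suc-zero : ∀ m n → T (suc m) (suc n) 0 ≡ T (suc m) n 0
T-suc-zero m n = begin
  T (suc m) (suc n) 0                                        ≡⟨ T≡countB-stirlingPerms m (suc n) 0 ⟩
  countB descents₀ (stirlingPerms (suc m) (suc n))           ≡⟨ countB-concatMap _ _ _ 1 0 _ (stirlingPerms (suc m) n) each ⟩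
  count * 1 + count * 0                                      ≡⟨ simplify count ⟩
  count                                                      ≡⟨ T≡countB-stirlingPerms m n 0 ⟨
  T (suc m) n 0                                              ∎
  where
  open ≡-Reasoning
  descents₀ : List ℕ → Bool
  descents₀ w = des w ≡ᵇ 0
  count : ℕ
  count = countB descents₀ (stirlingPerms (suc m) n)
  simplify : ∀ c → c * 1 + c * 0 ≡ c
  simplify = solve-∀
  each : ∀ {w} → w ∈ stirlingPerms (suc m) n →
         countB descents₀ (insertions (replicate (suc m) 1) (map suc w)) ≡ 𝟙 (descents₀ w) * 1 + 𝟙 (descents₀ w) * 0
  each {w} w∈ = trans (countB-des-insertions-stirlingPerm m n 0 w∈)
    (cong₂ _+_ (𝟙-≡ᵇ-subst (des w) 0 suc) (sym (ℕ.*-zeroʳ (𝟙 (descents₀ w)))))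

T-suc-suc : ∀ m n k → T (suc m) (suc n) (suc k) ≡ T (suc m) n (suc k) * suc (suc k) + T (suc m) n k * (suc m * n ∸ k)
T-suc-suc m n k = begin
  T (suc m) (suc n) (suc k)
    ≡⟨ T≡countB-stirlingPerms m (suc n) (suc k) ⟩
  countB (λ w → des w ≡ᵇ suc k) (stirlingPerms (suc m) (suc n))
    ≡⟨ countB-concatMap _ _ _ (suc (suc k)) (suc m * n ∸ k) _ (stirlingPerms (suc m) n) each ⟩
  count (suc k) * suc (suc k) + count k * (suc m * n ∸ k)
    ≡⟨ cong₂ (λ a b → a * suc (suc k) + b * (suc m * n ∸ k))
             (T≡countB-stirlingPerms m n (suc k)) (T≡countB-stirlingPerms m n k) ⟨
  T (suc m) n (suc k) * suc (suc k) + T (suc m) n k * (suc m * n ∸ k)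
    ∎
  where
  open ≡-Reasoning
  count : ℕ → ℕ
  count e = countB (λ w → des w ≡ᵇ e) (stirlingPerms (suc m) n)
  each : ∀ {w} → w ∈ stirlingPerms (suc m) n →
         countB (λ y → des y ≡ᵇ suc k) (insertions (replicate (suc m) 1) (map suc w))
           ≡ 𝟙 (des w ≡ᵇ suc k) * suc (suc k) + 𝟙 (des w ≡ᵇ k) * (suc m * n ∸ k)
  each {w} w∈ = trans (countB-des-insertions-stirlingPerm m n (suc k) w∈)
    (cong₂ _+_ (𝟙-≡ᵇ-subst (des w) (suc k) suc) (𝟙-≡ᵇ-subst (des w) k (suc m * n ∸_)))

T-vanishes : ∀ m n k → n < k → T (suc m) (suc n) k ≡ 0
T-vanishes m n k n<k = trans (T≡countB-stirlingPerms m (suc n) k) (countB-none _ (stirlingPerms (suc m) (suc n)) des≢k)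
  where
  des≢k : ∀ {w} → w ∈ stirlingPerms (suc m) (suc n) → (des w ≡ᵇ k) ≡ false
  des≢k w∈ = ≢⇒≡ᵇ-false (ℕ.<⇒≢ (ℕ.≤-<-trans (des-stirlingPerms-≤ m n w∈) n<k))

-- Generating functions

S≡T : ∀ m n k → S (suc m) (suc n) k ≡ pos (T (suc m) (suc n) k)
S≡T m n k with k <ᵇ suc n in k<ᵇ
... | true  = refl
... | false = cong pos (sym (T-vanishes m n k (ℕ.≮⇒≥ (λ k<sn → subst Bool.T k<ᵇ (ℕ.<⇒<ᵇ k<sn)))))

-- The truncated subtraction is exact only for k ≤ m(n+1); beyond that T vanishes.
T-weight : ∀ m n k → T (suc m) (suc n) k * (suc m * suc n ∸ k) + T (suc m) (suc n) k * suc k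
                       ≡ T (suc m) (suc n) k * (suc m * suc n + 1)
T-weight m n k with k ≤? suc m * suc n
... | yes k≤M = begin
  t * (M ∸ k) + t * suc k   ≡⟨ ℕ.*-distribˡ-+ t (M ∸ k) (suc k) ⟨
  t * (M ∸ k + suc k)       ≡⟨ cong (t *_) (trans (ℕ.+-suc (M ∸ k) k) (cong suc (ℕ.m∸n+n≡m k≤M))) ⟩
  t * suc M                 ≡⟨ cong (t *_) (ℕ.+-comm 1 M) ⟩
  t * (M + 1)               ∎
  where
  open ≡-Reasoning
  M t : ℕ
  M = suc m * suc n
  t = T (suc m) (suc n) k
... | no k≰M
  rewrite T-vanishes m n k (ℕ.<-≤-trans (ℕ.n<1+n n) (ℕ.≤-trans (ℕ.m≤n*m (suc n) (suc m)) (ℕ.<⇒≤ (ℕ.≰⇒> k≰M))))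
  = refl

+-≡⇒≡-ℤ : ∀ {a b c} → a + b ≡ c → pos a ≡ pos c -ℤ pos b
+-≡⇒≡-ℤ {a} {b} refl = trans (cancel (pos a) (pos b)) (cong (_-ℤ pos b) (sym (pos-+ a b)))
  where
  cancel : ∀ x y → x ≡ (x +ℤ y) -ℤ y
  cancel = solve-∀-ℤ

-- Coefficientwise this is the recurrence T(n+1,k+1) = (k+2) T(n,k+1) + (mn-k) T(n,k).
S-recurrence : ∀ m n → quotientNumerator (suc m * suc n + 1) (shiftT (S (suc m) (suc n))) ≈ₚ S (suc m) (suc (suc n))
S-recurrence m n zero =
  trans (drop-zero (pos (T (suc m) (suc n) 0)) (pos (suc m * suc n + 1))) (cong pos (sym (T-suc-zero m (suc n))))
  where
  drop-zero : ∀ a c → pos 1 *ℤ a +ℤ c *ℤ pos 0 ≡ a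
  drop-zero = solve-∀-ℤ
S-recurrence m n (suc k) = begin
  (pos (suc (suc k)) *ℤ S₁ (suc k) -ℤ pos (suc k) *ℤ S₁ k) +ℤ pos (M + 1) *ℤ S₁ k
      ≡⟨ cong₂ (λ a b → (pos (suc (suc k)) *ℤ a -ℤ pos (suc k) *ℤ b) +ℤ pos (M + 1) *ℤ b)
               (S≡T m n (suc k)) (S≡T m n k) ⟩
  (pos (suc (suc k)) *ℤ pos t₁ -ℤ pos (suc k) *ℤ pos t₀) +ℤ pos (M + 1) *ℤ pos t₀
      ≡⟨ rearrange (pos (suc (suc k))) (pos (suc k)) (pos (M + 1)) (pos t₁) (pos t₀) ⟩
  pos t₁ *ℤ pos (suc (suc k)) +ℤ (pos t₀ *ℤ pos (M + 1) -ℤ pos t₀ *ℤ pos (suc k))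
      ≡⟨ cong₂ _+ℤ_ (pos-* t₁ (suc (suc k))) weighted ⟨
  pos (t₁ * suc (suc k)) +ℤ pos (t₀ * (M ∸ k))
      ≡⟨ pos-+ (t₁ * suc (suc k)) (t₀ * (M ∸ k)) ⟨
  pos (t₁ * suc (suc k) + t₀ * (M ∸ k))
      ≡⟨ cong pos (T-suc-suc m (suc n) k) ⟨
  pos (T (suc m) (suc (suc n)) (suc k))
      ≡⟨ S≡T m (suc n) (suc k) ⟨
  S (suc m) (suc (suc n)) (suc k) ∎
  where
  open ≡-Reasoning
  M t₀ t₁ : ℕ
  M  = suc m * suc n
  t₀ = T (suc m) (suc n) k
  t₁ = T (suc m) (suc n) (suc k)
  S₁ : PS
  S₁ = S (suc m) (suc n)
  rearrange : ∀ a b c x y → (a *ℤ x -ℤ b *ℤ y) +ℤ c *ℤ y ≡ x *ℤ a +ℤ (y *ℤ c -ℤ y *ℤ b)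
  rearrange = solve-∀-ℤ
  weighted : pos (t₀ * (M ∸ k)) ≡ pos t₀ *ℤ pos (M + 1) -ℤ pos t₀ *ℤ pos (suc k)
  weighted = trans (+-≡⇒≡-ℤ (T-weight m n k)) (cong₂ _-ℤ_ (pos-* t₀ (M + 1)) (pos-* t₀ (suc k)))

Fhat≈divPow-shiftT-F : ∀ m n → Fhat (suc m) (suc n) ≈ₚ divPow m (shiftT (F (suc m) (suc n)))
Fhat≈divPow-shiftT-F m n = begin
  divPow (suc m * suc n + 1) (shiftT S₁)           ≡⟨ cong (λ j → divPow j (shiftT S₁)) (exponents m n) ⟨
  divPow (m + (suc m * n + 2)) (shiftT S₁)         ≡⟨ iter-+ m (suc m * n + 2) divOneMinus (shiftT S₁) ⟨
  divPow m (divPow (suc m * n + 2) (shiftT S₁))    ≈⟨ divPow-cong m (shiftT-divPow (suc m * n + 2) S₁) ⟨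
  divPow m (shiftT (divPow (suc m * n + 2) S₁))    ∎
  where
  open ≈ₚ-Reasoning
  S₁ : PS
  S₁ = S (suc m) (suc n)
  exponents : ∀ m n → m + (suc m * n + 2) ≡ suc m * suc n + 1
  exponents = solve-∀

deriv-divPow-shiftT-F : ∀ m n → deriv (divPow m (shiftT (F (suc m) (suc n)))) ≈ₚ F (suc m) (suc (suc n))
deriv-divPow-shiftT-F m n = begin
  deriv (divPow m (shiftT (F (suc m) (suc n))))     ≈⟨ deriv-cong (Fhat≈divPow-shiftT-F m n) ⟨
  deriv (divPow N (shiftT Sₙ))                      ≈⟨ deriv-divPow N (shiftT Sₙ) ⟩
  divPow (suc N) (quotientNumerator N (shiftT Sₙ))  ≈⟨ divPow-cong (suc N) (S-recurrence m n) ⟩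
  divPow (suc N) Sₙ₊₁                               ≡⟨ cong (λ j → divPow j Sₙ₊₁) (ℕ.+-suc (suc m * suc n) 1) ⟨
  divPow (suc m * suc n + 2) Sₙ₊₁                   ∎
  where
  open ≈ₚ-Reasoning
  N : ℕ
  N = suc m * suc n + 1
  Sₙ Sₙ₊₁ : PS
  Sₙ   = S (suc m) (suc n)
  Sₙ₊₁ = S (suc m) (suc (suc n))

shiftT-deriv-Fhat : ∀ m n → shiftT (deriv (Fhat (suc m) (suc n))) ≈ₚ mulPow m (Fhat (suc m) (suc (suc n)))
shiftT-deriv-Fhat m n = begin
  shiftT (deriv (Fhat (suc m) (suc n)))                           ≈⟨ shiftT-cong (deriv-cong (Fhat≈divPow-shiftT-F m n)) ⟩
  shiftT (deriv (divPow m (shiftT (F (suc m) (suc n)))))          ≈⟨ shiftT-cong (deriv-divPow-shiftT-F m n) ⟩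
  shiftT (F (suc m) (suc (suc n)))                                ≈⟨ mulPow-divPow m _ ⟨
  mulPow m (divPow m (shiftT (F (suc m) (suc (suc n)))))          ≈⟨ mulPow-cong m (Fhat≈divPow-shiftT-F m (suc n)) ⟨
  mulPow m (Fhat (suc m) (suc (suc n)))                           ∎
  where open ≈ₚ-Reasoning

theorem3p2 : (m n : ℕ) → m ≥ 1 → n ≥ 1 →
    (Fhat m n ≈ₚ divPow (m ∸ 1) (shiftT (F m n)))
    × (deriv (divPow (m ∸ 1) (shiftT (F m n))) ≈ₚ F m (suc n))
    × (shiftT (deriv (Fhat m n)) ≈ₚ mulPow (m ∸ 1) (Fhat m (suc n)))
    × (Fhat 1 n ≈ₚ shiftT (F 1 n))
    × (deriv (shiftT (F 1 n)) ≈ₚ F 1 (suc n))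
    × (shiftT (deriv (Fhat 1 n)) ≈ₚ Fhat 1 (suc n))
theorem3p2 (suc m) (suc n) _ _ =
    Fhat≈divPow-shiftT-F m n , deriv-divPow-shiftT-F m n , shiftT-deriv-Fhat m n
  , Fhat≈divPow-shiftT-F 0 n , deriv-divPow-shiftT-F 0 n , shiftT-deriv-Fhat 0 n
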